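{- Let $\boxtimes$ denote either the normal product $\boxtimes_{\min}$ or the strong product $\boxtimes_{\max}$. If $H_1$ and $H_2$ are thin hypergraphs, then $S(H_1\boxtimes H_2)=S(H_1)\,\Box\, S(H_2)$.
   Context: All hypergraphs $H=(V,E)$ are finite ($E$ a set of nonempty subsets of $V$), simple ($|e|\ge2$ for all edges, no edge properly contained in another) and connected. $N[v]$ is $v$ together with all vertices sharing an edge with $v$; $H$ is thin if $N[u]\ne N[v]$ for distinct $u,v$. Products of $H_1=(V_1,E_1)$, $H_2=(V_2,E_2)$ have vertex set $V_1\times V_2$ with projections $p_1,p_2$ (applied to sets elementwise). Cartesian product $\Box$: $e$ is an edge iff for some $\{i,j\}=\{1,2\}$, $p_i(e)\in E_i$ and $|p_j(e)|=1$. Strong product $\boxtimes_{\max}$: $e$ is an edge iff it is an edge of $H_1\Box H_2$, or $p_i(e)\in E_i$ for $i=1,2$ and $|e|=\max_i|p_i(e)|$. Normal product $\boxtimes_{\min}$: $e$ is an edge iff it is an edge of $H_1\Box H_2$, or there are $e_i\in E_i$ with $p_i(e)\subseteq e_i$ ($i=1,2$) and $|e|=|p_1(e)|=|p_2(e)|=\min\{|e_1|,|e_2|\}$. An edge $e$ is dispensable if there are a vertex $z$ and distinct $x,y\in e$ with (1) $N[x]\cap N[y]\subsetneq N[x]\cap N[z]$ or $N[x]\subsetneq N[z]\subsetneq N[y]$, and (2) $N[x]\cap N[y]\subsetneq N[y]\cap N[z]$ or $N[y]\subsetneq N[z]\subsetneq N[x]$. The Cartesian skeleton $S(H)$ has vertex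 set $V(H)$ and edge set $E(H)$ minus the dispensable edges. -}

module Defs where

open import Data.Bool using (Bool; true; false; T; if_then_else_)
open import Data.Nat using (ℕ; zero; suc; _≤_; _⊔_; _⊓_)
open import Data.List using (List; []; _∷_; cartesianProduct)
open import Data.Bool.ListAction using (any)
open import Data.List.Membership.Propositional using (_∈_)
open import Data.List.Relation.Unary.Unique.Propositional using (Unique)
open import Data.Product using (Σ; Σ-syntax; _×_; _,_; proj₁; proj₂)
open import Data.Sum using (_⊎_)
open import Relation.Nullary using (¬_; Dec)
open import Relation.Binary.PropositionalEquality using (_≡_; _≢_; _≗_)
open import Relation.Binary.Definitions using (DecidableEquality)
open import Relation.Unary using (Pred; _⊆_; _⊂_; _∩_; _≐_)
open import Level using (0ℓ)

Sub : Set → Set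
Sub V = V → Bool

_∈ₛ_ : {V : Set} → V → Sub V → Set
x ∈ₛ e = T (e x)

_⊆ₛ_ : {V : Set} → Sub V → Sub V → Set
e ⊆ₛ f = ∀ x → x ∈ₛ e → x ∈ₛ f

-- cardinality of a subset, counted along an enumeration of the vertex type
-- (correct when the enumeration is duplicate-free and complete).
size : {V : Set} → List V → Sub V → ℕ
size []       e = 0
size (v ∷ vs) e = if e v then suc (size vs e) else size vs e

EdgeSet : Set → Set₁
EdgeSet V = Sub V → Set

data Reach {V : Set} (E : EdgeSet V) : V → V → Set where
  here : ∀ {x} → Reach E x x
  step : ∀ {x y w} (f : Sub V) → E f → x ∈ₛ f → y ∈ₛ f → Reach E y w → Reach E x w

record Hypergraph (V : Set) : Set₁ where
  field
    -- finiteness of V (Bishop-finite: decidable equality + complete duplicate-free list)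
    _≟_       : DecidableEquality V
    vertices  : List V
    unique    : Unique vertices
    complete  : ∀ x → x ∈ vertices
    Edge      : EdgeSet V
    Edge-resp : ∀ {e f} → e ≗ f → Edge e → Edge f
    Edge-dec  : ∀ e → Dec (Edge e)
    -- simple: every edge has at least two vertices, no edge properly contained in another
    Edge-size : ∀ e → Edge e → 2 ≤ size vertices e
    antichain : ∀ e f → Edge e → Edge f → e ⊆ₛ f → e ≗ f
    connected : ∀ x y → Reach Edge x y

N : {V : Set} → EdgeSet V → V → Pred V 0ℓ
N E x u = (u ≡ x) ⊎ (Σ[ f ∈ Sub _ ] (E f × x ∈ₛ f × u ∈ₛ f))

Thin : {V : Set} → Hypergraph V → Set
Thin {V} H = ∀ (u v : V) → u ≢ v → ¬ (N (Hypergraph.Edge H) u ≐ N (Hypergraph.Edge H) v)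

Dispensable : {V : Set} → EdgeSet V → Sub V → Set
Dispensable {V} E e =
  Σ[ z ∈ V ] Σ[ x ∈ V ] Σ[ y ∈ V ]
    (x ≢ y × x ∈ₛ e × y ∈ₛ e
    × ((N E x ∩ N E y ⊂ N E x ∩ N E z) ⊎ (N E x ⊂ N E z × N E z ⊂ N E y))
    × ((N E x ∩ N E y ⊂ N E y ∩ N E z) ⊎ (N E y ⊂ N E z × N E z ⊂ N E x)))

Skel : {V : Set} → EdgeSet V → EdgeSet V
Skel E e = E e × ¬ Dispensable E e

p₁ : {A B : Set} → List B → Sub (A × B) → Sub A
p₁ bs e a = any (λ b → e (a , b)) bs

p₂ : {A B : Set} → List A → Sub (A × B) → Sub B
p₂ as e b = any (λ a → e (a , b)) as

module _ {A B : Set} (as : List A) (bs : List B) where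

  private
    ab = cartesianProduct as bs

  Cart : EdgeSet A → EdgeSet B → EdgeSet (A × B)
  Cart E₁ E₂ e =
      (E₁ (p₁ bs e) × size bs (p₂ as e) ≡ 1)
    ⊎ (E₂ (p₂ as e) × size as (p₁ bs e) ≡ 1)

  Strong : EdgeSet A → EdgeSet B → EdgeSet (A × B)
  Strong E₁ E₂ e =
      Cart E₁ E₂ e
    ⊎ (E₁ (p₁ bs e) × E₂ (p₂ as e)
       × size ab e ≡ size as (p₁ bs e) ⊔ size bs (p₂ as e))

  Normal : EdgeSet A → EdgeSet B → EdgeSet (A × B)
  Normal E₁ E₂ e =
      Cart E₁ E₂ e
    ⊎ (Σ[ e₁ ∈ Sub A ] Σ[ e₂ ∈ Sub B ]
        (E₁ e₁ × E₂ e₂ × p₁ bs e ⊆ₛ e₁ × p₂ as e ⊆ₛ e₂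
        × size ab e ≡ size as (p₁ bs e)
        × size ab e ≡ size bs (p₂ as e)
        × size ab e ≡ size as e₁ ⊓ size bs e₂))

data ProductKind : Set where
  normal strong : ProductKind

Prod : ProductKind → {V₁ V₂ : Set} → Hypergraph V₁ → Hypergraph V₂ → EdgeSet (V₁ × V₂)
Prod normal H₁ H₂ = Normal (Hypergraph.vertices H₁) (Hypergraph.vertices H₂) (Hypergraph.Edge H₁) (Hypergraph.Edge H₂)
Prod strong H₁ H₂ = Strong (Hypergraph.vertices H₁) (Hypergraph.vertices H₂) (Hypergraph.Edge H₁) (Hypergraph.Edge H₂)

-- In either product the closed neighbourhood of (a , b) is N[a] × N[b].  For an edge lying in
-- a layer (one projection a single vertex) the dispensability witnesses therefore correspond to
-- those of its projection, so the edge is dispensable in the product iff its projection is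
-- dispensable in the factor.  Every other edge contains two vertices (x₁ , x₂), (y₁ , y₂) that
-- differ in both coordinates; by thinness N[x₁] ≠ N[y₁] and N[x₂] ≠ N[y₂], and comparing these
-- neighbourhoods shows that one of the corners (x₁ , y₂), (y₁ , x₂) witnesses the dispensability
-- of the edge.  Hence exactly the Cartesian edges with indispensable projections survive.
module Submission where

open import Defs
open import Data.Bool using (true; false; _∧_; if_then_else_)
open import Data.Bool.Properties using (T-∧)
open import Data.Empty using (⊥; ⊥-elim)
open import Data.Nat using (suc; _≤_; z≤n; s≤s; _⊔_; _⊓_)
open import Data.Nat.Properties using (≤-total; ⊓-glb; ⊔-identityʳ)
open import Data.List using (List; []; _∷_; length; map; zip; take; filter; filterᵇ; cartesianProduct)
open import Data.List.Properties using (length-map; length-zipWith; take-[])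
open import Data.List.Membership.Propositional using (_∈_; lose)
open import Data.List.Membership.Propositional.Properties
  using (∈-filter⁺; ∈-filter⁻; ∈-map⁺; ∈-map⁻; ∈-cartesianProduct⁺)
open import Data.List.Membership.Propositional.Properties.WithK using (unique∧set⇒bag)
import Data.List.Membership.DecPropositional as DecMembership
open import Data.List.Relation.Binary.BagAndSetEquality using (∼bag⇒↭)
open import Data.List.Relation.Binary.Permutation.Propositional.Properties using (↭-length)
open import Data.List.Relation.Unary.All using ([]; _∷_)
import Data.List.Relation.Unary.All as All
open import Data.List.Relation.Unary.Any using (here; there; satisfied)
open import Data.List.Relation.Unary.Any.Properties using (any⁺; any⁻)
open import Data.List.Relation.Unary.Unique.Propositional using (Unique; []; _∷_)
open import Data.List.Relation.Unary.Unique.Propositional.Properties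
  using (filter⁺; map⁻; take⁺; cartesianProduct⁺)
open import Data.Product using (Σ-syntax; ∃-syntax; _×_; _,_; proj₁; proj₂)
open import Data.Product.Properties using (≡-dec)
open import Data.Sum using (_⊎_; inj₁; inj₂; [_,_])
import Data.Sum as Sum
open import Function using (_∘_; id)
open import Function.Bundles using (_⇔_; mk⇔; Equivalence)
open import Function.Construct.Composition using (_⇔-∘_)
open import Function.Construct.Symmetry using (⇔-sym)
open import Level using (0ℓ)
open import Relation.Binary.Definitions using (DecidableEquality)
open import Relation.Binary.PropositionalEquality
  using (_≡_; _≢_; _≗_; refl; sym; trans; cong; cong₂; subst; ≢-sym)
open import Relation.Nullary using (¬_; Dec; yes; no; ¬¬-excluded-middle)
open import Relation.Nullary.Decidable using (T?; ¬?; _×-dec_; ⌊_⌋; toWitness; fromWitness)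
open import Relation.Unary using (Pred; Decidable; Satisfiable; _⊆_; _⊂_; _∩_; _≐_; _⟨×⟩_)
open import Relation.Unary.Properties using (⊂-respˡ-≐; ⊂-respʳ-≐; ≐-refl; ≐-sym)

module _ {A B : Set} where

  ⟨×⟩-⊆⁻ˡ : {P P′ : Pred A 0ℓ} {Q Q′ : Pred B 0ℓ}
          → (P ⟨×⟩ Q) ⊆ (P′ ⟨×⟩ Q′) → Satisfiable Q → P ⊆ P′
  ⟨×⟩-⊆⁻ˡ PQ⊆P′Q′ (b , q) {a} p = proj₁ (PQ⊆P′Q′ {a , b} (p , q))

  ⟨×⟩-⊆⁻ʳ : {P P′ : Pred A 0ℓ} {Q Q′ : Pred B 0ℓ}
          → (P ⟨×⟩ Q) ⊆ (P′ ⟨×⟩ Q′) → Satisfiable P → Q ⊆ Q′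
  ⟨×⟩-⊆⁻ʳ PQ⊆P′Q′ (a , p) {b} q = proj₂ (PQ⊆P′Q′ {a , b} (p , q))

  ∩-⟨×⟩ˡ : {P P′ : Pred A 0ℓ} {Q : Pred B 0ℓ} → ((P ⟨×⟩ Q) ∩ (P′ ⟨×⟩ Q)) ≐ ((P ∩ P′) ⟨×⟩ Q)
  ∩-⟨×⟩ˡ = (λ ((p , q) , (p′ , _)) → (p , p′) , q) , (λ ((p , p′) , q) → (p , q) , (p′ , q))

  ∩-⟨×⟩ʳ : {P : Pred A 0ℓ} {Q Q′ : Pred B 0ℓ} → ((P ⟨×⟩ Q) ∩ (P ⟨×⟩ Q′)) ≐ (P ⟨×⟩ (Q ∩ Q′))
  ∩-⟨×⟩ʳ = (λ ((p , q) , (_ , q′)) → p , (q , q′)) , (λ (p , (q , q′)) → (p , q) , (p , q′))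

module _ {A B : Set} {P P′ : Pred A 0ℓ} {Q Q′ : Pred B 0ℓ} where

  ⟨×⟩-⊂ˡ : P ⊂ P′ → Q ⊆ Q′ → Satisfiable Q′ → (P ⟨×⟩ Q) ⊂ (P′ ⟨×⟩ Q′)
  ⟨×⟩-⊂ˡ (P⊆P′ , P′⊈P) Q⊆Q′ q′ =
    (λ (p , q) → P⊆P′ p , Q⊆Q′ q) , λ h → P′⊈P (⟨×⟩-⊆⁻ˡ {P = P′} {P} {Q′} {Q} h q′)

  ⟨×⟩-⊂ʳ : P ⊆ P′ → Q ⊂ Q′ → Satisfiable P′ → (P ⟨×⟩ Q) ⊂ (P′ ⟨×⟩ Q′)
  ⟨×⟩-⊂ʳ P⊆P′ (Q⊆Q′ , Q′⊈Q) p′ =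
    (λ (p , q) → P⊆P′ p , Q⊆Q′ q) , λ h → Q′⊈Q (⟨×⟩-⊆⁻ʳ {P = P′} {P} {Q′} {Q} h p′)

  ⟨×⟩-⊂⁻ˡ : (P ⟨×⟩ Q) ⊂ (P′ ⟨×⟩ Q′) → Satisfiable Q → Q′ ⊆ Q → P ⊂ P′
  ⟨×⟩-⊂⁻ˡ (h , h′) q Q′⊆Q =
    ⟨×⟩-⊆⁻ˡ {P = P} {P′} {Q} {Q′} h q , λ P′⊆P → h′ (λ (p′ , q′) → P′⊆P p′ , Q′⊆Q q′)

  ⟨×⟩-⊂⁻ʳ : (P ⟨×⟩ Q) ⊂ (P′ ⟨×⟩ Q′) → Satisfiable P → P′ ⊆ P → Q ⊂ Q′
  ⟨×⟩-⊂⁻ʳ (h , h′) p P′⊆P =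
    ⟨×⟩-⊆⁻ʳ {P = P} {P′} {Q} {Q′} h p , λ Q′⊆Q → h′ (λ (p′ , q′) → P′⊆P p′ , Q′⊆Q q′)

  ∩-⟨×⟩ : ((P ⟨×⟩ Q) ∩ (P′ ⟨×⟩ Q′)) ≐ ((P ∩ P′) ⟨×⟩ (Q ∩ Q′))
  ∩-⟨×⟩ = (λ ((p , q) , (p′ , q′)) → (p , p′) , (q , q′))
        , (λ ((p , p′) , (q , q′)) → (p , q) , (p′ , q′))

module _ {V : Set} where

  ∩-resp-≐ : {X X′ Z Z′ : Pred V 0ℓ} → X ≐ X′ → Z ≐ Z′ → (X ∩ Z) ≐ (X′ ∩ Z′)
  ∩-resp-≐ (X⊆X′ , X′⊆X) (Z⊆Z′ , Z′⊆Z) =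
    (λ (x , z) → X⊆X′ x , Z⊆Z′ z) , (λ (x , z) → X′⊆X x , Z′⊆Z z)

  ∩-comm-≐ : {X Z : Pred V 0ℓ} → (X ∩ Z) ≐ (Z ∩ X)
  ∩-comm-≐ = (λ (x , z) → z , x) , (λ (z , x) → x , z)

  ⊂-resp : {I I′ J J′ : Pred V 0ℓ} → I ≐ I′ → J ≐ J′ → I ⊂ J → I′ ⊂ J′
  ⊂-resp I≐I′ J≐J′ I⊂J = ⊂-respˡ-≐ I≐I′ (⊂-respʳ-≐ J≐J′ I⊂J)

  ∩-⊂ˡ : {X Y : Pred V 0ℓ} → ¬ (X ⊆ Y) → (X ∩ Y) ⊂ (X ∩ X)
  ∩-⊂ˡ X⊈Y = (λ (x , _) → x , x) , λ h → X⊈Y λ x → proj₂ (h (x , x))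

  ∩-⊂ʳ : {X Y : Pred V 0ℓ} → ¬ (Y ⊆ X) → (X ∩ Y) ⊂ (Y ∩ Y)
  ∩-⊂ʳ Y⊈X = (λ (_ , y) → y , y) , λ h → Y⊈X λ y → proj₁ (h (y , y))

-- Conditions (1) and (2) on x, y, z read  Closer (N x ∩ N y) (N x) (N z) (N y)  and
-- Closer (N x ∩ N y) (N y) (N z) (N x), so  Dispensable E e  unfolds definitionally to
-- Σ z x y (x ≢ y × x ∈ₛ e × y ∈ₛ e × Dispenses (N E) x y z).
Closer : {V : Set} → Pred V 0ℓ → Pred V 0ℓ → Pred V 0ℓ → Pred V 0ℓ → Set
Closer I X Z Y = (I ⊂ X ∩ Z) ⊎ (X ⊂ Z × Z ⊂ Y)

Dispenses : {V : Set} → (V → Pred V 0ℓ) → V → V → V → Set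
Dispenses N x y z = Closer (N x ∩ N y) (N x) (N z) (N y) × Closer (N x ∩ N y) (N y) (N z) (N x)

module _ {V : Set} {I I′ X X′ Z Z′ Y Y′ : Pred V 0ℓ} where

  Closer-resp : I ≐ I′ → X ≐ X′ → Z ≐ Z′ → Y ≐ Y′ → Closer I X Z Y → Closer I′ X′ Z′ Y′
  Closer-resp I≐ X≐ Z≐ Y≐ (inj₁ I⊂X∩Z)         = inj₁ (⊂-resp I≐ (∩-resp-≐ X≐ Z≐) I⊂X∩Z)
  Closer-resp I≐ X≐ Z≐ Y≐ (inj₂ (X⊂Z , Z⊂Y)) = inj₂ (⊂-resp X≐ Z≐ X⊂Z , ⊂-resp Z≐ Y≐ Z⊂Y)

module _ {V : Set} {N N′ : V → Pred V 0ℓ} (N≐N′ : ∀ v → N v ≐ N′ v) where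

  Dispenses-resp : ∀ {x y z} → Dispenses N x y z → Dispenses N′ x y z
  Dispenses-resp {x} {y} {z} (c₁ , c₂) = Closer-resp I≐ (N≐N′ x) (N≐N′ z) (N≐N′ y) c₁
                                       , Closer-resp I≐ (N≐N′ y) (N≐N′ z) (N≐N′ x) c₂
    where
    I≐ : (N x ∩ N y) ≐ (N′ x ∩ N′ y)
    I≐ = ∩-resp-≐ (N≐N′ x) (N≐N′ y)

Dispenses-swap : {V : Set} {N : V → Pred V 0ℓ} {x y z : V} → Dispenses N x y z → Dispenses N y x z
Dispenses-swap (c₁ , c₂) = Closer-resp ∩-comm-≐ ≐-refl ≐-refl ≐-refl c₂
                         , Closer-resp ∩-comm-≐ ≐-refl ≐-refl ≐-refl c₁

module _ {A B : Set} {I X Z Y : Pred A 0ℓ} where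

  Closer-⟨×⟩ˡ : {Q : Pred B 0ℓ} → Satisfiable Q → Closer I X Z Y
              → Closer (I ⟨×⟩ Q) (X ⟨×⟩ Q) (Z ⟨×⟩ Q) (Y ⟨×⟩ Q)
  Closer-⟨×⟩ˡ {Q} q (inj₁ I⊂X∩Z) =
    inj₁ (⊂-respʳ-≐ (≐-sym (∩-⟨×⟩ˡ {P = X} {Z} {Q})) (⟨×⟩-⊂ˡ I⊂X∩Z (λ q → q) q))
  Closer-⟨×⟩ˡ q (inj₂ (X⊂Z , Z⊂Y)) = inj₂ (⟨×⟩-⊂ˡ X⊂Z (λ q → q) q , ⟨×⟩-⊂ˡ Z⊂Y (λ q → q) q)

  Closer-⟨×⟩⁻ˡ : {Q Q′ : Pred B 0ℓ} → Satisfiable Q → Satisfiable X → Satisfiable Z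
               → Closer (I ⟨×⟩ Q) (X ⟨×⟩ Q) (Z ⟨×⟩ Q′) (Y ⟨×⟩ Q) → Closer I X Z Y
  Closer-⟨×⟩⁻ˡ {Q} {Q′} q x z (inj₁ IQ⊂XQ∩ZQ′) =
    inj₁ (⟨×⟩-⊂⁻ˡ {Q′ = Q ∩ Q′} (⊂-respʳ-≐ ∩-⟨×⟩ IQ⊂XQ∩ZQ′) q proj₁)
  Closer-⟨×⟩⁻ˡ {Q} {Q′} q x z (inj₂ (XQ⊂ZQ′ , ZQ′⊂YQ)) =
    inj₂ (⟨×⟩-⊂⁻ˡ XQ⊂ZQ′ q Q′⊆Q , ⟨×⟩-⊂⁻ˡ ZQ′⊂YQ (proj₁ q , Q⊆Q′ (proj₂ q)) Q⊆Q′)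
    where
    Q⊆Q′ : Q ⊆ Q′
    Q⊆Q′ = ⟨×⟩-⊆⁻ʳ {P = X} {Z} {Q} {Q′} (proj₁ XQ⊂ZQ′) x
    Q′⊆Q : Q′ ⊆ Q
    Q′⊆Q = ⟨×⟩-⊆⁻ʳ {P = Z} {Y} {Q′} {Q} (proj₁ ZQ′⊂YQ) z

module _ {A B : Set} {I X Z Y : Pred B 0ℓ} where

  Closer-⟨×⟩ʳ : {P : Pred A 0ℓ} → Satisfiable P → Closer I X Z Y
              → Closer (P ⟨×⟩ I) (P ⟨×⟩ X) (P ⟨×⟩ Z) (P ⟨×⟩ Y)
  Closer-⟨×⟩ʳ {P} p (inj₁ I⊂X∩Z) =
    inj₁ (⊂-respʳ-≐ (≐-sym (∩-⟨×⟩ʳ {P = P} {Q = X} {Z})) (⟨×⟩-⊂ʳ (λ p → p) I⊂X∩Z p))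
  Closer-⟨×⟩ʳ p (inj₂ (X⊂Z , Z⊂Y)) = inj₂ (⟨×⟩-⊂ʳ (λ p → p) X⊂Z p , ⟨×⟩-⊂ʳ (λ p → p) Z⊂Y p)

  Closer-⟨×⟩⁻ʳ : {P P′ : Pred A 0ℓ} → Satisfiable P → Satisfiable X → Satisfiable Z
               → Closer (P ⟨×⟩ I) (P ⟨×⟩ X) (P′ ⟨×⟩ Z) (P ⟨×⟩ Y) → Closer I X Z Y
  Closer-⟨×⟩⁻ʳ {P} {P′} p x z (inj₁ PI⊂PX∩P′Z) =
    inj₁ (⟨×⟩-⊂⁻ʳ {P′ = P ∩ P′} (⊂-respʳ-≐ ∩-⟨×⟩ PI⊂PX∩P′Z) p proj₁)
  Closer-⟨×⟩⁻ʳ {P} {P′} p x z (inj₂ (PX⊂P′Z , P′Z⊂PY)) =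
    inj₂ (⟨×⟩-⊂⁻ʳ PX⊂P′Z p P′⊆P , ⟨×⟩-⊂⁻ʳ P′Z⊂PY (proj₁ p , P⊆P′ (proj₂ p)) P⊆P′)
    where
    P⊆P′ : P ⊆ P′
    P⊆P′ = ⟨×⟩-⊆⁻ˡ {P = P} {P′} {X} {Z} (proj₁ PX⊂P′Z) x
    P′⊆P : P′ ⊆ P
    P′⊆P = ⟨×⟩-⊆⁻ˡ {P = P′} {P} {Z} {Y} (proj₁ P′Z⊂PY) z

module ProductNeighbourhood {A B : Set} (NA : A → Pred A 0ℓ) (NB : B → Pred B 0ℓ)
  (NA-refl : ∀ a → NA a a) (NB-refl : ∀ b → NB b b) where

  N⊗ : A × B → Pred (A × B) 0ℓ
  N⊗ (a , b) = NA a ⟨×⟩ NB b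

  Dispenses-row⁺ : ∀ {x y z b} → Dispenses NA x y z → Dispenses N⊗ (x , b) (y , b) (z , b)
  Dispenses-row⁺ {x} {y} {b = b} (c₁ , c₂) = lift c₁ , lift c₂
    where
    lift : ∀ {X Z Y} → Closer (NA x ∩ NA y) X Z Y
         → Closer ((NA x ⟨×⟩ NB b) ∩ (NA y ⟨×⟩ NB b)) (X ⟨×⟩ NB b) (Z ⟨×⟩ NB b) (Y ⟨×⟩ NB b)
    lift c = Closer-resp (≐-sym ∩-⟨×⟩ˡ) ≐-refl ≐-refl ≐-refl (Closer-⟨×⟩ˡ (b , NB-refl b) c)

  Dispenses-row⁻ : ∀ {x y b z} → Dispenses N⊗ (x , b) (y , b) z → Dispenses NA x y (proj₁ z)
  Dispenses-row⁻ {x} {y} {b} {z₁ , z₂} (c₁ , c₂) = drop (x , NA-refl x) c₁ , drop (y , NA-refl y) c₂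
    where
    drop : ∀ {X Y} → Satisfiable X
         → Closer ((NA x ⟨×⟩ NB b) ∩ (NA y ⟨×⟩ NB b)) (X ⟨×⟩ NB b) (NA z₁ ⟨×⟩ NB z₂) (Y ⟨×⟩ NB b)
         → Closer (NA x ∩ NA y) X (NA z₁) Y
    drop sx c = Closer-⟨×⟩⁻ˡ (b , NB-refl b) sx (z₁ , NA-refl z₁)
                  (Closer-resp ∩-⟨×⟩ˡ ≐-refl ≐-refl ≐-refl c)

  Dispenses-col⁺ : ∀ {a x y z} → Dispenses NB x y z → Dispenses N⊗ (a , x) (a , y) (a , z)
  Dispenses-col⁺ {a} {x} {y} (c₁ , c₂) = lift c₁ , lift c₂
    where
    lift : ∀ {X Z Y} → Closer (NB x ∩ NB y) X Z Y
         → Closer ((NA a ⟨×⟩ NB x) ∩ (NA a ⟨×⟩ NB y)) (NA a ⟨×⟩ X) (NA a ⟨×⟩ Z) (NA a ⟨×⟩ Y)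
    lift c = Closer-resp (≐-sym ∩-⟨×⟩ʳ) ≐-refl ≐-refl ≐-refl (Closer-⟨×⟩ʳ (a , NA-refl a) c)

  Dispenses-col⁻ : ∀ {a x y z} → Dispenses N⊗ (a , x) (a , y) z → Dispenses NB x y (proj₂ z)
  Dispenses-col⁻ {a} {x} {y} {z₁ , z₂} (c₁ , c₂) = drop (x , NB-refl x) c₁ , drop (y , NB-refl y) c₂
    where
    drop : ∀ {X Y} → Satisfiable X
         → Closer ((NA a ⟨×⟩ NB x) ∩ (NA a ⟨×⟩ NB y)) (NA a ⟨×⟩ X) (NA z₁ ⟨×⟩ NB z₂) (NA a ⟨×⟩ Y)
         → Closer (NB x ∩ NB y) X (NB z₂) Y
    drop sx c = Closer-⟨×⟩⁻ʳ (a , NA-refl a) sx (z₂ , NB-refl z₂)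
                  (Closer-resp ∩-⟨×⟩ʳ ≐-refl ≐-refl ≐-refl c)

  Dispenses-corner : ∀ {x₁ x₂ y₁ y₂} → NA x₁ y₁ → NB y₂ x₂
    → ¬ (NA x₁ ⊆ NA y₁) ⊎ (NA x₁ ⊂ NA y₁ × NB x₂ ⊂ NB y₂) → ¬ (NB y₂ ⊆ NB x₂)
    → Dispenses N⊗ (x₁ , x₂) (y₁ , y₂) (x₁ , y₂)
  Dispenses-corner {x₁} {x₂} {y₁} {y₂} x₁~y₁ y₂~x₂ near B₂⊈A₂ = closer-x near , closer-y
    where
    closer-x : ¬ (NA x₁ ⊆ NA y₁) ⊎ (NA x₁ ⊂ NA y₁ × NB x₂ ⊂ NB y₂)
             → Closer (N⊗ (x₁ , x₂) ∩ N⊗ (y₁ , y₂)) (N⊗ (x₁ , x₂)) (N⊗ (x₁ , y₂)) (N⊗ (y₁ , y₂))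
    closer-x (inj₁ A₁⊈B₁) =
      inj₁ (⊂-resp (≐-sym ∩-⟨×⟩) (≐-sym ∩-⟨×⟩) (⟨×⟩-⊂ˡ (∩-⊂ˡ A₁⊈B₁) (λ q → q) (x₂ , NB-refl x₂ , y₂~x₂)))
    closer-x (inj₂ (A₁⊂B₁ , A₂⊂B₂)) =
      inj₂ (⟨×⟩-⊂ʳ (λ p → p) A₂⊂B₂ (x₁ , NA-refl x₁) , ⟨×⟩-⊂ˡ A₁⊂B₁ (λ q → q) (y₂ , NB-refl y₂))
    closer-y : Closer (N⊗ (x₁ , x₂) ∩ N⊗ (y₁ , y₂)) (N⊗ (y₁ , y₂)) (N⊗ (x₁ , y₂)) (N⊗ (x₁ , x₂))
    closer-y =
      inj₁ (⊂-resp (≐-sym ∩-⟨×⟩) (≐-sym ∩-⟨×⟩)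
                   (⟨×⟩-⊂ʳ (λ (p , p′) → p′ , p) (∩-⊂ʳ B₂⊈A₂) (y₁ , NA-refl y₁ , x₁~y₁)))

  -- Stated doubly negated: which corner works depends on inclusions between neighbourhoods,
  -- which are not decidable.
  crossing-dispensed : ∀ {x₁ x₂ y₁ y₂} → NA x₁ y₁ → NA y₁ x₁ → NB x₂ y₂ → NB y₂ x₂
    → ¬ (NA x₁ ≐ NA y₁) → ¬ (NB x₂ ≐ NB y₂)
    → ¬ (∀ z → ¬ Dispenses N⊗ (x₁ , x₂) (y₁ , y₂) z)
  crossing-dispensed {x₁} {x₂} {y₁} {y₂} x₁~y₁ y₁~x₁ x₂~y₂ y₂~x₂ A₁≉B₁ A₂≉B₂ none =
    ¬¬-excluded-middle λ d₁ → ¬¬-excluded-middle λ d₂ →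
    ¬¬-excluded-middle λ d₃ → ¬¬-excluded-middle λ d₄ → cases d₁ d₂ d₃ d₄
    where
    at-xy : ¬ (NA x₁ ⊆ NA y₁) ⊎ (NA x₁ ⊂ NA y₁ × NB x₂ ⊂ NB y₂) → ¬ (NB y₂ ⊆ NB x₂) → ⊥
    at-xy near B₂⊈A₂ = none (x₁ , y₂) (Dispenses-corner x₁~y₁ y₂~x₂ near B₂⊈A₂)
    at-yx : ¬ (NA y₁ ⊆ NA x₁) ⊎ (NA y₁ ⊂ NA x₁ × NB y₂ ⊂ NB x₂) → ¬ (NB x₂ ⊆ NB y₂) → ⊥
    at-yx near A₂⊈B₂ = none (y₁ , x₂) (Dispenses-swap {N = N⊗} (Dispenses-corner y₁~x₁ x₂~y₂ near A₂⊈B₂))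
    cases : Dec (NB y₂ ⊆ NB x₂) → Dec (NA y₁ ⊆ NA x₁) → Dec (NA x₁ ⊆ NA y₁) → Dec (NB x₂ ⊆ NB y₂) → ⊥
    cases (yes B₂⊆A₂) (yes B₁⊆A₁) _ _ =
      at-yx (inj₂ ((B₁⊆A₁ , λ A₁⊆B₁ → A₁≉B₁ (A₁⊆B₁ , B₁⊆A₁)) , (B₂⊆A₂ , A₂⊈B₂))) A₂⊈B₂
      where
      A₂⊈B₂ : ¬ (NB x₂ ⊆ NB y₂)
      A₂⊈B₂ A₂⊆B₂ = A₂≉B₂ (A₂⊆B₂ , B₂⊆A₂)
    cases (yes B₂⊆A₂) (no B₁⊈A₁) _ _ = at-yx (inj₁ B₁⊈A₁) λ A₂⊆B₂ → A₂≉B₂ (A₂⊆B₂ , B₂⊆A₂)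
    cases (no B₂⊈A₂) _ (no A₁⊈B₁) _ = at-xy (inj₁ A₁⊈B₁) B₂⊈A₂
    cases (no B₂⊈A₂) _ (yes A₁⊆B₁) (yes A₂⊆B₂) =
      at-xy (inj₂ ((A₁⊆B₁ , λ B₁⊆A₁ → A₁≉B₁ (A₁⊆B₁ , B₁⊆A₁)) , (A₂⊆B₂ , B₂⊈A₂))) B₂⊈A₂
    cases (no B₂⊈A₂) _ (yes A₁⊆B₁) (no A₂⊈B₂) =
      at-yx (inj₁ λ B₁⊆A₁ → A₁≉B₁ (A₁⊆B₁ , B₁⊆A₁)) A₂⊈B₂

module _ {A B : Set} (_≟₁_ : DecidableEquality A) (_≟₂_ : DecidableEquality B) where

  crossing-pair : (R : Pred (A × B) 0ℓ) → Satisfiable R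
    → (∀ a → ∃[ p ] (R p × proj₁ p ≢ a)) → (∀ b → ∃[ p ] (R p × proj₂ p ≢ b))
    → ∃[ p ] ∃[ q ] (R p × R q × proj₁ p ≢ proj₁ q × proj₂ p ≢ proj₂ q)
  crossing-pair R ((x₁ , x₂) , x∈R) other₁ other₂ with other₁ x₁ | other₂ x₂
  ... | (u₁ , v) , u∈R , u₁≢x₁ | (u , u₂) , w∈R , u₂≢x₂ with v ≟₂ x₂ | u ≟₁ x₁
  ...   | no v≢x₂  | _        = _ , _ , x∈R , u∈R , ≢-sym u₁≢x₁ , ≢-sym v≢x₂
  ...   | yes refl | no u≢x₁  = _ , _ , x∈R , w∈R , ≢-sym u≢x₁ , ≢-sym u₂≢x₂
  ...   | yes refl | yes refl = _ , _ , u∈R , w∈R , u₁≢x₁ , ≢-sym u₂≢x₂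

module _ {V : Set} where

  ⟦_⟧ : {P : Pred V 0ℓ} → Decidable P → Sub V
  ⟦ P? ⟧ x = ⌊ P? x ⌋

  ∈-⟦⟧ : {P : Pred V 0ℓ} {P? : Decidable P} {x : V} → x ∈ₛ ⟦ P? ⟧ ⇔ P x
  ∈-⟦⟧ = mk⇔ toWitness fromWitness

  ⇔⇒≗ : {s t : Sub V} → (∀ {x} → x ∈ₛ s ⇔ x ∈ₛ t) → s ≗ t
  ⇔⇒≗ {s} {t} s⇔t x with s x | t x | Equivalence.to (s⇔t {x}) | Equivalence.from (s⇔t {x})
  ... | false | false | _   | _   = refl
  ... | false | true  | _   | t⇒s = ⊥-elim (t⇒s _)
  ... | true  | false | s⇒t | _   = ⊥-elim (s⇒t _)
  ... | true  | true  | _   | _   = refl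

  size≡length-filter : (vs : List V) (s : Sub V) → size vs s ≡ length (filterᵇ s vs)
  size≡length-filter []       s = refl
  size≡length-filter (v ∷ vs) s with s v
  ... | true  = cong suc (size≡length-filter vs s)
  ... | false = size≡length-filter vs s

  length≡1⇒≡ : {L : List V} {x y : V} → length L ≡ 1 → x ∈ L → y ∈ L → x ≡ y
  length≡1⇒≡ {_ ∷ []} _ (here refl) (here refl) = refl

  2≤length⇒distinct : {L : List V} → Unique L → 2 ≤ length L → Σ[ x ∈ V ] Σ[ y ∈ V ] (x ∈ L × y ∈ L × x ≢ y)
  2≤length⇒distinct {x ∷ y ∷ _} ((x≢y ∷ _) ∷ _) _ = x , y , here refl , there (here refl) , x≢y
  2≤length⇒distinct {_ ∷ []} _ (s≤s ())

module Counting {V : Set} {vs : List V} (vs-unique : Unique vs) (vs-complete : ∀ x → x ∈ vs) where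

  members : Sub V → List V
  members s = filterᵇ s vs

  ∈-members : ∀ {s x} → x ∈ members s ⇔ x ∈ₛ s
  ∈-members {s} {x} = mk⇔ (proj₂ ∘ ∈-filter⁻ (T? ∘ s) {xs = vs}) (∈-filter⁺ (T? ∘ s) (vs-complete x))

  size≡length : ∀ s {L} → Unique L → (∀ {x} → x ∈ L ⇔ x ∈ₛ s) → size vs s ≡ length L
  size≡length s L! L⇔s = trans (size≡length-filter vs s)
    (↭-length (∼bag⇒↭ (unique∧set⇒bag (filter⁺ (T? ∘ s) vs-unique) L!
      (⇔-sym L⇔s ⇔-∘ ∈-members))))

  size≡1⇒≡ : ∀ {s x y} → size vs s ≡ 1 → x ∈ₛ s → y ∈ₛ s → x ≡ y
  size≡1⇒≡ {s} eq x∈s y∈s =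
    length≡1⇒≡ (trans (sym (size≡length-filter vs s)) eq)
               (Equivalence.from ∈-members x∈s) (Equivalence.from ∈-members y∈s)

  2≤size⇒distinct : ∀ {s} → 2 ≤ size vs s → Σ[ x ∈ V ] Σ[ y ∈ V ] (x ∈ₛ s × y ∈ₛ s × x ≢ y)
  2≤size⇒distinct {s} 2≤size =
    let x , y , x∈ , y∈ , x≢y = 2≤length⇒distinct (filter⁺ (T? ∘ s) vs-unique)
                                   (subst (2 ≤_) (size≡length-filter vs s) 2≤size)
    in  x , y , Equivalence.to ∈-members x∈ , Equivalence.to ∈-members y∈ , x≢y

  module _ (_≟_ : DecidableEquality V) where

    listing : ∀ {f a u} → a ∈ₛ f → u ∈ₛ f → a ≢ u
            → Σ[ r ∈ List V ] (Unique (a ∷ u ∷ r) × (∀ {x} → x ∈ a ∷ u ∷ r ⇔ x ∈ₛ f))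
    listing {f} {a} {u} a∈f u∈f a≢u =
      r , (a≢u ∷ All.tabulate (≢-sym ∘ a≢)) ∷ All.tabulate (≢-sym ∘ u≢) ∷ r! , mk⇔ to from
      where
      Other : V → Set
      Other x = x ≢ a × x ≢ u
      other? : Decidable Other
      other? x = ¬? (x ≟ a) ×-dec ¬? (x ≟ u)
      r : List V
      r = filter other? (members f)
      r! : Unique r
      r! = filter⁺ other? (filter⁺ (T? ∘ f) vs-unique)
      a≢ : ∀ {x} → x ∈ r → x ≢ a
      a≢ = proj₁ ∘ proj₂ ∘ ∈-filter⁻ other? {xs = members f}
      u≢ : ∀ {x} → x ∈ r → x ≢ u
      u≢ = proj₂ ∘ proj₂ ∘ ∈-filter⁻ other? {xs = members f}
      to : ∀ {x} → x ∈ a ∷ u ∷ r → x ∈ₛ f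
      to (here refl)         = a∈f
      to (there (here refl)) = u∈f
      to (there (there x∈r)) = Equivalence.to ∈-members (proj₁ (∈-filter⁻ other? {xs = members f} x∈r))
      from : ∀ {x} → x ∈ₛ f → x ∈ a ∷ u ∷ r
      from {x} x∈f with x ≟ a | x ≟ u
      ... | yes refl | _        = here refl
      ... | no _     | yes refl = there (here refl)
      ... | no x≢a   | no x≢u   = there (there (∈-filter⁺ other? (Equivalence.from ∈-members x∈f) (x≢a , x≢u)))

    size-singleton : ∀ b → size vs ⟦ _≟ b ⟧ ≡ 1
    size-singleton b =
      size≡length ⟦ _≟ b ⟧ ([] ∷ []) (mk⇔ (λ { (here refl) → fromWitness refl }) (here ∘ toWitness))

module _ {A B : Set} where

  map-proj₁-zip : (xs : List A) (ys : List B) → map proj₁ (zip xs ys) ≡ take (length ys) xs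
  map-proj₁-zip []       ys       = sym (take-[] (length ys))
  map-proj₁-zip (x ∷ xs) []       = refl
  map-proj₁-zip (x ∷ xs) (y ∷ ys) = cong (x ∷_) (map-proj₁-zip xs ys)

  map-proj₂-zip : (xs : List A) (ys : List B) → map proj₂ (zip xs ys) ≡ take (length xs) ys
  map-proj₂-zip []       ys       = refl
  map-proj₂-zip (x ∷ xs) []       = refl
  map-proj₂-zip (x ∷ xs) (y ∷ ys) = cong (y ∷_) (map-proj₂-zip xs ys)

  ∈-zip⁻ : ∀ {xs : List A} {ys : List B} {x y} → (x , y) ∈ zip xs ys → x ∈ xs × y ∈ ys
  ∈-zip⁻ {_ ∷ _} {_ ∷ _} (here refl) = here refl , here refl
  ∈-zip⁻ {_ ∷ _} {_ ∷ _} (there p)   = let x∈ , y∈ = ∈-zip⁻ p in there x∈ , there y∈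

  padZip : A → B → List A → List B → List (A × B)
  padZip u v []       []       = []
  padZip u v []       (y ∷ ys) = (u , y) ∷ padZip u v [] ys
  padZip u v (x ∷ xs) []       = (x , v) ∷ padZip u v xs []
  padZip u v (x ∷ xs) (y ∷ ys) = (x , y) ∷ padZip u v xs ys

  module _ {u : A} {v : B} where

    length-padZip : ∀ xs ys → length (padZip u v xs ys) ≡ length xs ⊔ length ys
    length-padZip []       []       = refl
    length-padZip []       (y ∷ ys) = cong suc (length-padZip [] ys)
    length-padZip (x ∷ xs) []       = cong suc (trans (length-padZip xs []) (⊔-identityʳ (length xs)))
    length-padZip (x ∷ xs) (y ∷ ys) = cong suc (length-padZip xs ys)

    map-proj₁-padZip : ∀ xs ys → length ys ≤ length xs → map proj₁ (padZip u v xs ys) ≡ xs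
    map-proj₁-padZip []       []       _         = refl
    map-proj₁-padZip (x ∷ xs) []       _         = cong (x ∷_) (map-proj₁-padZip xs [] z≤n)
    map-proj₁-padZip (x ∷ xs) (y ∷ ys) (s≤s ys≤) = cong (x ∷_) (map-proj₁-padZip xs ys ys≤)

    map-proj₂-padZip : ∀ xs ys → length xs ≤ length ys → map proj₂ (padZip u v xs ys) ≡ ys
    map-proj₂-padZip []       []       _         = refl
    map-proj₂-padZip []       (y ∷ ys) _         = cong (y ∷_) (map-proj₂-padZip [] ys z≤n)
    map-proj₂-padZip (x ∷ xs) (y ∷ ys) (s≤s xs≤) = cong (y ∷_) (map-proj₂-padZip xs ys xs≤)

    ∈-padZip₁⁺ : ∀ {x} xs ys → x ∈ xs → x ∈ map proj₁ (padZip u v xs ys)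
    ∈-padZip₁⁺ (_ ∷ _)  []       (here refl) = here refl
    ∈-padZip₁⁺ (_ ∷ xs) []       (there x∈)  = there (∈-padZip₁⁺ xs [] x∈)
    ∈-padZip₁⁺ (_ ∷ _)  (_ ∷ _)  (here refl) = here refl
    ∈-padZip₁⁺ (_ ∷ xs) (_ ∷ ys) (there x∈)  = there (∈-padZip₁⁺ xs ys x∈)

    ∈-padZip₂⁺ : ∀ {y} xs ys → y ∈ ys → y ∈ map proj₂ (padZip u v xs ys)
    ∈-padZip₂⁺ []       (_ ∷ _)  (here refl) = here refl
    ∈-padZip₂⁺ []       (_ ∷ ys) (there y∈)  = there (∈-padZip₂⁺ [] ys y∈)
    ∈-padZip₂⁺ (_ ∷ _)  (_ ∷ _)  (here refl) = here refl
    ∈-padZip₂⁺ (_ ∷ xs) (_ ∷ ys) (there y∈)  = there (∈-padZip₂⁺ xs ys y∈)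

    ∈-padZip₁⁻ : ∀ {x} xs ys → x ∈ map proj₁ (padZip u v xs ys) → x ∈ xs ⊎ x ≡ u
    ∈-padZip₁⁻ []       (_ ∷ _)  (here refl) = inj₂ refl
    ∈-padZip₁⁻ []       (_ ∷ ys) (there x∈)  = ∈-padZip₁⁻ [] ys x∈
    ∈-padZip₁⁻ (_ ∷ _)  []       (here refl) = inj₁ (here refl)
    ∈-padZip₁⁻ (_ ∷ xs) []       (there x∈)  = Sum.map₁ there (∈-padZip₁⁻ xs [] x∈)
    ∈-padZip₁⁻ (_ ∷ _)  (_ ∷ _)  (here refl) = inj₁ (here refl)
    ∈-padZip₁⁻ (_ ∷ xs) (_ ∷ ys) (there x∈)  = Sum.map₁ there (∈-padZip₁⁻ xs ys x∈)

    ∈-padZip₂⁻ : ∀ {y} xs ys → y ∈ map proj₂ (padZip u v xs ys) → y ∈ ys ⊎ y ≡ v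
    ∈-padZip₂⁻ []       (_ ∷ _)  (here refl) = inj₁ (here refl)
    ∈-padZip₂⁻ []       (_ ∷ ys) (there y∈)  = Sum.map₁ there (∈-padZip₂⁻ [] ys y∈)
    ∈-padZip₂⁻ (_ ∷ _)  []       (here refl) = inj₂ refl
    ∈-padZip₂⁻ (_ ∷ xs) []       (there y∈)  = ∈-padZip₂⁻ xs [] y∈
    ∈-padZip₂⁻ (_ ∷ _)  (_ ∷ _)  (here refl) = inj₁ (here refl)
    ∈-padZip₂⁻ (_ ∷ xs) (_ ∷ ys) (there y∈)  = Sum.map₁ there (∈-padZip₂⁻ xs ys y∈)

size-resp : {V : Set} (vs : List V) {s t : Sub V} → s ≗ t → size vs s ≡ size vs t
size-resp []       s≗t = refl
size-resp (v ∷ vs) {s} {t} s≗t rewrite s≗t v = cong (λ n → if t v then suc n else n) (size-resp vs s≗t)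

Adjacent : {V : Set} → EdgeSet V → V → V → Set
Adjacent {V} E x u = Σ[ f ∈ Sub V ] (E f × x ∈ₛ f × u ∈ₛ f)

module HypergraphProduct {V₁ V₂ : Set} (H₁ : Hypergraph V₁) (H₂ : Hypergraph V₂) where

  open Hypergraph H₁ public using () renaming
    ( _≟_ to _≟₁_; vertices to vs₁; unique to vs₁!; complete to ∈vs₁
    ; Edge to E₁; Edge-resp to E₁-resp; Edge-size to E₁-size)
  open Hypergraph H₂ public using () renaming
    ( _≟_ to _≟₂_; vertices to vs₂; unique to vs₂!; complete to ∈vs₂
    ; Edge to E₂; Edge-resp to E₂-resp; Edge-size to E₂-size)

  vs : List (V₁ × V₂)
  vs = cartesianProduct vs₁ vs₂

  _≟_ : DecidableEquality (V₁ × V₂)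
  _≟_ = ≡-dec _≟₁_ _≟₂_

  module C₁ = Counting vs₁! ∈vs₁
  module C₂ = Counting vs₂! ∈vs₂
  module C  = Counting (cartesianProduct⁺ vs₁! vs₂!) (λ (a , b) → ∈-cartesianProduct⁺ (∈vs₁ a) (∈vs₂ b))

  p₁⁺ : ∀ {e : Sub (V₁ × V₂)} {a b} → (a , b) ∈ₛ e → a ∈ₛ p₁ vs₂ e
  p₁⁺ {e} {a} {b} ab∈e = any⁺ (λ y → e (a , y)) (lose (∈vs₂ b) ab∈e)

  p₂⁺ : ∀ {e : Sub (V₁ × V₂)} {a b} → (a , b) ∈ₛ e → b ∈ₛ p₂ vs₁ e
  p₂⁺ {e} {a} {b} ab∈e = any⁺ (λ x → e (x , b)) (lose (∈vs₁ a) ab∈e)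

  p₁⁻ : ∀ {e : Sub (V₁ × V₂)} {a} → a ∈ₛ p₁ vs₂ e → Σ[ b ∈ V₂ ] (a , b) ∈ₛ e
  p₁⁻ {e} {a} a∈ = satisfied (any⁻ (λ y → e (a , y)) vs₂ a∈)

  p₂⁻ : ∀ {e : Sub (V₁ × V₂)} {b} → b ∈ₛ p₂ vs₁ e → Σ[ a ∈ V₁ ] (a , b) ∈ₛ e
  p₂⁻ {e} {b} b∈ = satisfied (any⁻ (λ x → e (x , b)) vs₁ b∈)

  _⊠_ : Sub V₁ → Sub V₂ → Sub (V₁ × V₂)
  (f ⊠ g) (a , b) = f a ∧ g b

  p₁-⊠ : ∀ {f g b} → b ∈ₛ g → p₁ vs₂ (f ⊠ g) ≗ f
  p₁-⊠ {f} {g} b∈g = ⇔⇒≗ (mk⇔ (λ x∈ → proj₁ (Equivalence.to T-∧ (proj₂ (p₁⁻ {f ⊠ g} x∈))))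
                              (λ x∈f → p₁⁺ {f ⊠ g} (Equivalence.from T-∧ (x∈f , b∈g))))

  p₂-⊠ : ∀ {f g a} → a ∈ₛ f → p₂ vs₁ (f ⊠ g) ≗ g
  p₂-⊠ {f} {g} a∈f = ⇔⇒≗ (mk⇔ (λ y∈ → proj₂ (Equivalence.to T-∧ (proj₂ (p₂⁻ {f ⊠ g} y∈))))
                              (λ y∈g → p₂⁺ {f ⊠ g} (Equivalence.from T-∧ (a∈f , y∈g))))

  ｛_｝₁ : V₁ → Sub V₁
  ｛ a ｝₁ = ⟦ _≟₁ a ⟧

  ｛_｝₂ : V₂ → Sub V₂
  ｛ b ｝₂ = ⟦ _≟₂ b ⟧

  cart⇒prod : ∀ k {e} → Cart vs₁ vs₂ E₁ E₂ e → Prod k H₁ H₂ e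
  cart⇒prod normal = inj₁
  cart⇒prod strong = inj₁

  row-adjacent : ∀ k {a u} b → Adjacent E₁ a u → Adjacent (Prod k H₁ H₂) (a , b) (u , b)
  row-adjacent k b (f , Ef , a∈f , u∈f) =
    f ⊠ ｛ b ｝₂ , cart⇒prod k (inj₁ (E₁-resp (sym ∘ p₁-⊠ b∈｛b｝) Ef , size-row))
    , Equivalence.from T-∧ (a∈f , b∈｛b｝) , Equivalence.from T-∧ (u∈f , b∈｛b｝)
    where
    b∈｛b｝ : b ∈ₛ ｛ b ｝₂
    b∈｛b｝ = fromWitness refl
    size-row : size vs₂ (p₂ vs₁ (f ⊠ ｛ b ｝₂)) ≡ 1
    size-row = trans (size-resp vs₂ (p₂-⊠ a∈f)) (C₂.size-singleton _≟₂_ b)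

  col-adjacent : ∀ k a {b v} → Adjacent E₂ b v → Adjacent (Prod k H₁ H₂) (a , b) (a , v)
  col-adjacent k a (g , Eg , b∈g , v∈g) =
    ｛ a ｝₁ ⊠ g , cart⇒prod k (inj₂ (E₂-resp (sym ∘ p₂-⊠ a∈｛a｝) Eg , size-col))
    , Equivalence.from T-∧ (a∈｛a｝ , b∈g) , Equivalence.from T-∧ (a∈｛a｝ , v∈g)
    where
    a∈｛a｝ : a ∈ₛ ｛ a ｝₁
    a∈｛a｝ = fromWitness refl
    size-col : size vs₁ (p₁ vs₂ (｛ a ｝₁ ⊠ g)) ≡ 1
    size-col = trans (size-resp vs₁ (p₁-⊠ b∈g)) (C₁.size-singleton _≟₁_ a)

  open DecMembership _≟_ using (_∈?_)

  graph : List (V₁ × V₂) → Sub (V₁ × V₂)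
  graph L = ⟦ _∈? L ⟧

  ∈-graph : ∀ {L p} → p ∈ₛ graph L ⇔ p ∈ L
  ∈-graph {L} = ∈-⟦⟧ {P? = _∈? L}

  size-graph : ∀ {L} → Unique L → size vs (graph L) ≡ length L
  size-graph {L} L! = C.size≡length (graph L) L! (⇔-sym ∈-graph)

  p₁-graph : ∀ {L x} → x ∈ₛ p₁ vs₂ (graph L) ⇔ x ∈ map proj₁ L
  p₁-graph {L} = mk⇔ (λ x∈ → ∈-map⁺ proj₁ (toWitness (proj₂ (p₁⁻ {graph L} x∈)))) (from ∘ ∈-map⁻ proj₁)
    where
    from : ∀ {x} → Σ[ p ∈ V₁ × V₂ ] (p ∈ L × x ≡ proj₁ p) → x ∈ₛ p₁ vs₂ (graph L)
    from (_ , p∈L , refl) = p₁⁺ {graph L} (fromWitness p∈L)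

  p₂-graph : ∀ {L y} → y ∈ₛ p₂ vs₁ (graph L) ⇔ y ∈ map proj₂ L
  p₂-graph {L} = mk⇔ (λ y∈ → ∈-map⁺ proj₂ (toWitness (proj₂ (p₂⁻ {graph L} y∈)))) (from ∘ ∈-map⁻ proj₂)
    where
    from : ∀ {y} → Σ[ p ∈ V₁ × V₂ ] (p ∈ L × y ≡ proj₂ p) → y ∈ₛ p₂ vs₁ (graph L)
    from (_ , p∈L , refl) = p₂⁺ {graph L} (fromWitness p∈L)

  module _ {f₁ : Sub V₁} {f₂ : Sub V₂} {l₁ : List V₁} {l₂ : List V₂}
           (Ef₁ : E₁ f₁) (Ef₂ : E₂ f₂) (l₁! : Unique l₁) (l₂! : Unique l₂)
           (l₁⇔f₁ : ∀ {x} → x ∈ l₁ ⇔ x ∈ₛ f₁) (l₂⇔f₂ : ∀ {y} → y ∈ l₂ ⇔ y ∈ₛ f₂) where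

    zip-normal : Normal vs₁ vs₂ E₁ E₂ (graph (zip l₁ l₂))
    zip-normal = inj₂ (f₁ , f₂ , Ef₁ , Ef₂ , p₁⊆f₁ , p₂⊆f₂
                      , trans size-L (sym size-p₁) , trans size-L (sym size-p₂) , trans size-L length-L)
      where
      L : List (V₁ × V₂)
      L = zip l₁ l₂
      L₁! : Unique (map proj₁ L)
      L₁! = subst Unique (sym (map-proj₁-zip l₁ l₂)) (take⁺ (length l₂) l₁!)
      L₂! : Unique (map proj₂ L)
      L₂! = subst Unique (sym (map-proj₂-zip l₁ l₂)) (take⁺ (length l₁) l₂!)
      size-L : size vs (graph L) ≡ length L
      size-L = size-graph (map⁻ L₁!)
      size-p₁ : size vs₁ (p₁ vs₂ (graph L)) ≡ length L
      size-p₁ = trans (C₁.size≡length _ L₁! (⇔-sym p₁-graph)) (length-map proj₁ L)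
      size-p₂ : size vs₂ (p₂ vs₁ (graph L)) ≡ length L
      size-p₂ = trans (C₂.size≡length _ L₂! (⇔-sym p₂-graph)) (length-map proj₂ L)
      length-L : length L ≡ size vs₁ f₁ ⊓ size vs₂ f₂
      length-L = trans (length-zipWith _,_ l₁ l₂)
                       (sym (cong₂ _⊓_ (C₁.size≡length f₁ l₁! l₁⇔f₁) (C₂.size≡length f₂ l₂! l₂⇔f₂)))
      p₁⊆f₁ : p₁ vs₂ (graph L) ⊆ₛ f₁
      p₁⊆f₁ _ x∈ = Equivalence.to l₁⇔f₁ (proj₁ (∈-zip⁻ (toWitness (proj₂ (p₁⁻ {graph L} x∈)))))
      p₂⊆f₂ : p₂ vs₁ (graph L) ⊆ₛ f₂
      p₂⊆f₂ _ y∈ = Equivalence.to l₂⇔f₂ (proj₂ (∈-zip⁻ (toWitness (proj₂ (p₂⁻ {graph L} y∈)))))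

    padZip-strong : ∀ {u v} → u ∈ l₁ → v ∈ l₂ → Strong vs₁ vs₂ E₁ E₂ (graph (padZip u v l₁ l₂))
    padZip-strong {u} {v} u∈l₁ v∈l₂ =
      inj₂ ( E₁-resp (⇔⇒≗ (l₁⇔p₁ ⇔-∘ ⇔-sym l₁⇔f₁)) Ef₁
           , E₂-resp (⇔⇒≗ (l₂⇔p₂ ⇔-∘ ⇔-sym l₂⇔f₂)) Ef₂
           , trans (size-graph L!) (trans (length-padZip l₁ l₂) (sym size-p)))
      where
      L : List (V₁ × V₂)
      L = padZip u v l₁ l₂
      L! : Unique L
      L! with ≤-total (length l₂) (length l₁)
      ... | inj₁ l₂≤l₁ = map⁻ (subst Unique (sym (map-proj₁-padZip l₁ l₂ l₂≤l₁)) l₁!)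
      ... | inj₂ l₁≤l₂ = map⁻ (subst Unique (sym (map-proj₂-padZip l₁ l₂ l₁≤l₂)) l₂!)
      l₁⇔p₁ : ∀ {x} → x ∈ l₁ ⇔ x ∈ₛ p₁ vs₂ (graph L)
      l₁⇔p₁ = ⇔-sym p₁-graph ⇔-∘ mk⇔ (∈-padZip₁⁺ l₁ l₂) ([ id , (λ { refl → u∈l₁ }) ] ∘ ∈-padZip₁⁻ l₁ l₂)
      l₂⇔p₂ : ∀ {y} → y ∈ l₂ ⇔ y ∈ₛ p₂ vs₁ (graph L)
      l₂⇔p₂ = ⇔-sym p₂-graph ⇔-∘ mk⇔ (∈-padZip₂⁺ l₁ l₂) ([ id , (λ { refl → v∈l₂ }) ] ∘ ∈-padZip₂⁻ l₁ l₂)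
      size-p : size vs₁ (p₁ vs₂ (graph L)) ⊔ size vs₂ (p₂ vs₁ (graph L)) ≡ length l₁ ⊔ length l₂
      size-p = cong₂ _⊔_ (C₁.size≡length _ l₁! l₁⇔p₁) (C₂.size≡length _ l₂! l₂⇔p₂)

  listed-adjacent : ∀ k {f₁ f₂ a u b v r₁ r₂} → E₁ f₁ → E₂ f₂
    → Unique (a ∷ u ∷ r₁) → Unique (b ∷ v ∷ r₂)
    → (∀ {x} → x ∈ a ∷ u ∷ r₁ ⇔ x ∈ₛ f₁) → (∀ {y} → y ∈ b ∷ v ∷ r₂ ⇔ y ∈ₛ f₂)
    → Adjacent (Prod k H₁ H₂) (a , b) (u , v)
  listed-adjacent normal {a = a} {u} {b} {v} {r₁} {r₂} Ef₁ Ef₂ l₁! l₂! l₁⇔f₁ l₂⇔f₂ =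
    graph (zip (a ∷ u ∷ r₁) (b ∷ v ∷ r₂)) , zip-normal Ef₁ Ef₂ l₁! l₂! l₁⇔f₁ l₂⇔f₂
    , Equivalence.from ∈-graph (here refl) , Equivalence.from ∈-graph (there (here refl))
  listed-adjacent strong {a = a} {u} {b} {v} {r₁} {r₂} Ef₁ Ef₂ l₁! l₂! l₁⇔f₁ l₂⇔f₂ =
    graph (padZip u v (a ∷ u ∷ r₁) (b ∷ v ∷ r₂))
    , padZip-strong Ef₁ Ef₂ l₁! l₂! l₁⇔f₁ l₂⇔f₂ (there (here refl)) (there (here refl))
    , Equivalence.from ∈-graph (here refl) , Equivalence.from ∈-graph (there (here refl))

  diagonal-adjacent : ∀ k {a u b v} → Adjacent E₁ a u → Adjacent E₂ b v → a ≢ u → b ≢ v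
                    → Adjacent (Prod k H₁ H₂) (a , b) (u , v)
  diagonal-adjacent k (f₁ , Ef₁ , a∈ , u∈) (f₂ , Ef₂ , b∈ , v∈) a≢u b≢v =
    let _ , l₁! , l₁⇔f₁ = C₁.listing _≟₁_ a∈ u∈ a≢u
        _ , l₂! , l₂⇔f₂ = C₂.listing _≟₂_ b∈ v∈ b≢v
    in  listed-adjacent k Ef₁ Ef₂ l₁! l₂! l₁⇔f₁ l₂⇔f₂

  cart-neighbours : ∀ {e} → Cart vs₁ vs₂ E₁ E₂ e → ∀ {a b u v} → (a , b) ∈ₛ e → (u , v) ∈ₛ e
                  → N E₁ a u × N E₂ b v
  cart-neighbours {e} (inj₁ (E , s)) ab∈ uv∈ =
    inj₂ (p₁ vs₂ e , E , p₁⁺ {e} ab∈ , p₁⁺ {e} uv∈) , inj₁ (C₂.size≡1⇒≡ s (p₂⁺ {e} uv∈) (p₂⁺ {e} ab∈))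
  cart-neighbours {e} (inj₂ (E , s)) ab∈ uv∈ =
    inj₁ (C₁.size≡1⇒≡ s (p₁⁺ {e} uv∈) (p₁⁺ {e} ab∈)) , inj₂ (p₂ vs₁ e , E , p₂⁺ {e} ab∈ , p₂⁺ {e} uv∈)

  prod-neighbours : ∀ k {e} → Prod k H₁ H₂ e → ∀ {a b u v} → (a , b) ∈ₛ e → (u , v) ∈ₛ e
                  → N E₁ a u × N E₂ b v
  prod-neighbours normal (inj₁ c) = cart-neighbours c
  prod-neighbours strong (inj₁ c) = cart-neighbours c
  prod-neighbours normal {e} (inj₂ (f₁ , f₂ , Ef₁ , Ef₂ , p₁⊆f₁ , p₂⊆f₂ , _)) ab∈ uv∈ =
    inj₂ (f₁ , Ef₁ , p₁⊆f₁ _ (p₁⁺ {e} ab∈) , p₁⊆f₁ _ (p₁⁺ {e} uv∈)) ,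
    inj₂ (f₂ , Ef₂ , p₂⊆f₂ _ (p₂⁺ {e} ab∈) , p₂⊆f₂ _ (p₂⁺ {e} uv∈))
  prod-neighbours strong {e} (inj₂ (Ep₁ , Ep₂ , _)) ab∈ uv∈ =
    inj₂ (p₁ vs₂ e , Ep₁ , p₁⁺ {e} ab∈ , p₁⁺ {e} uv∈) , inj₂ (p₂ vs₁ e , Ep₂ , p₂⁺ {e} ab∈ , p₂⁺ {e} uv∈)

  N-Prod : ∀ k a b → N (Prod k H₁ H₂) (a , b) ≐ (N E₁ a ⟨×⟩ N E₂ b)
  N-Prod k a b = to , from
    where
    to : N (Prod k H₁ H₂) (a , b) ⊆ (N E₁ a ⟨×⟩ N E₂ b)
    to (inj₁ refl)                = inj₁ refl , inj₁ refl
    to (inj₂ (e , Ee , ab∈ , uv∈)) = prod-neighbours k Ee ab∈ uv∈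
    from : (N E₁ a ⟨×⟩ N E₂ b) ⊆ N (Prod k H₁ H₂) (a , b)
    from (inj₁ refl , inj₁ refl) = inj₁ refl
    from (inj₁ refl , inj₂ b~v)  = inj₂ (col-adjacent k a b~v)
    from (inj₂ a~u  , inj₁ refl) = inj₂ (row-adjacent k b a~u)
    from {u , v} (inj₂ a~u , inj₂ b~v) with u ≟₁ a | v ≟₂ b
    ... | yes refl | _        = inj₂ (col-adjacent k a b~v)
    ... | no _     | yes refl = inj₂ (row-adjacent k b a~u)
    ... | no u≢a   | no v≢b   = inj₂ (diagonal-adjacent k a~u b~v (≢-sym u≢a) (≢-sym v≢b))

  prod-edge-cases : ∀ k {e} → Prod k H₁ H₂ e
                  → Cart vs₁ vs₂ E₁ E₂ e ⊎ (2 ≤ size vs₁ (p₁ vs₂ e) × 2 ≤ size vs₂ (p₂ vs₁ e))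
  prod-edge-cases normal (inj₁ c) = inj₁ c
  prod-edge-cases strong (inj₁ c) = inj₁ c
  prod-edge-cases strong (inj₂ (Ep₁ , Ep₂ , _)) = inj₂ (E₁-size _ Ep₁ , E₂-size _ Ep₂)
  prod-edge-cases normal (inj₂ (f₁ , f₂ , Ef₁ , Ef₂ , _ , _ , size-p₁ , size-p₂ , size-min)) =
    inj₂ ( subst (2 ≤_) (trans (sym size-min) size-p₁) 2≤min
         , subst (2 ≤_) (trans (sym size-min) size-p₂) 2≤min)
    where
    2≤min : 2 ≤ size vs₁ f₁ ⊓ size vs₂ f₂
    2≤min = ⊓-glb (E₁-size f₁ Ef₁) (E₂-size f₂ Ef₂)

  spread₁ : ∀ {e} → 2 ≤ size vs₁ (p₁ vs₂ e) → ∀ a → ∃[ p ] (p ∈ₛ e × proj₁ p ≢ a)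
  spread₁ {e} 2≤size a with C₁.2≤size⇒distinct 2≤size
  ... | x , y , x∈ , y∈ , x≢y with x ≟₁ a
  ...   | yes refl = let b , yb∈e = p₁⁻ {e} y∈ in (y , b) , yb∈e , ≢-sym x≢y
  ...   | no x≢a   = let b , xb∈e = p₁⁻ {e} x∈ in (x , b) , xb∈e , x≢a

  spread₂ : ∀ {e} → 2 ≤ size vs₂ (p₂ vs₁ e) → ∀ b → ∃[ p ] (p ∈ₛ e × proj₂ p ≢ b)
  spread₂ {e} 2≤size b with C₂.2≤size⇒distinct 2≤size
  ... | x , y , x∈ , y∈ , x≢y with x ≟₂ b
  ...   | yes refl = let a , ay∈e = p₂⁻ {e} y∈ in (a , y) , ay∈e , ≢-sym x≢y
  ...   | no x≢b   = let a , ax∈e = p₂⁻ {e} x∈ in (a , x) , ax∈e , x≢b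

  module Skeleton (k : ProductKind) where

    open ProductNeighbourhood (N E₁) (N E₂) (λ _ → inj₁ refl) (λ _ → inj₁ refl)

    Dispenses-Prod⇒⊗ : ∀ {x y z} → Dispenses (N (Prod k H₁ H₂)) x y z → Dispenses N⊗ x y z
    Dispenses-Prod⇒⊗ = Dispenses-resp (λ (a , b) → N-Prod k a b)

    Dispenses-⊗⇒Prod : ∀ {x y z} → Dispenses N⊗ x y z → Dispenses (N (Prod k H₁ H₂)) x y z
    Dispenses-⊗⇒Prod = Dispenses-resp (λ (a , b) → ≐-sym (N-Prod k a b))

    Dispensable-row : ∀ {e} → size vs₂ (p₂ vs₁ e) ≡ 1
                    → Dispensable (Prod k H₁ H₂) e ⇔ Dispensable E₁ (p₁ vs₂ e)
    Dispensable-row {e} size≡1 = mk⇔ to from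
      where
      same-row : ∀ {a b a′ b′} → (a , b) ∈ₛ e → (a′ , b′) ∈ₛ e → b ≡ b′
      same-row ab∈ a′b′∈ = C₂.size≡1⇒≡ size≡1 (p₂⁺ {e} ab∈) (p₂⁺ {e} a′b′∈)
      to : Dispensable (Prod k H₁ H₂) e → Dispensable E₁ (p₁ vs₂ e)
      to ((z₁ , _) , (x₁ , x₂) , (y₁ , _) , x≢y , x∈e , y∈e , d) with same-row x∈e y∈e
      ... | refl = z₁ , x₁ , y₁ , x≢y ∘ cong (_, x₂) , p₁⁺ {e} x∈e , p₁⁺ {e} y∈e
                 , Dispenses-row⁻ (Dispenses-Prod⇒⊗ d)
      from : Dispensable E₁ (p₁ vs₂ e) → Dispensable (Prod k H₁ H₂) e
      from (z₁ , x₁ , y₁ , x₁≢y₁ , x₁∈ , y₁∈ , d) with p₁⁻ {e} x₁∈ | p₁⁻ {e} y₁∈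
      ... | b , x∈e | _ , y∈e with same-row x∈e y∈e
      ...   | refl = (z₁ , b) , (x₁ , b) , (y₁ , b) , x₁≢y₁ ∘ cong proj₁ , x∈e , y∈e
                   , Dispenses-⊗⇒Prod (Dispenses-row⁺ d)

    Dispensable-col : ∀ {e} → size vs₁ (p₁ vs₂ e) ≡ 1
                    → Dispensable (Prod k H₁ H₂) e ⇔ Dispensable E₂ (p₂ vs₁ e)
    Dispensable-col {e} size≡1 = mk⇔ to from
      where
      same-col : ∀ {a b a′ b′} → (a , b) ∈ₛ e → (a′ , b′) ∈ₛ e → a ≡ a′
      same-col ab∈ a′b′∈ = C₁.size≡1⇒≡ size≡1 (p₁⁺ {e} ab∈) (p₁⁺ {e} a′b′∈)
      to : Dispensable (Prod k H₁ H₂) e → Dispensable E₂ (p₂ vs₁ e)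
      to ((_ , z₂) , (x₁ , x₂) , (_ , y₂) , x≢y , x∈e , y∈e , d) with same-col x∈e y∈e
      ... | refl = z₂ , x₂ , y₂ , x≢y ∘ cong (x₁ ,_) , p₂⁺ {e} x∈e , p₂⁺ {e} y∈e
                 , Dispenses-col⁻ (Dispenses-Prod⇒⊗ d)
      from : Dispensable E₂ (p₂ vs₁ e) → Dispensable (Prod k H₁ H₂) e
      from (z₂ , x₂ , y₂ , x₂≢y₂ , x₂∈ , y₂∈ , d) with p₂⁻ {e} x₂∈ | p₂⁻ {e} y₂∈
      ... | a , x∈e | _ , y∈e with same-col x∈e y∈e
      ...   | refl = (a , z₂) , (a , x₂) , (a , y₂) , x₂≢y₂ ∘ cong proj₂ , x∈e , y∈e
                   , Dispenses-⊗⇒Prod (Dispenses-col⁺ d)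

    ¬¬-dispensable-non-cartesian : Thin H₁ → Thin H₂ → ∀ {e} → Prod k H₁ H₂ e
      → 2 ≤ size vs₁ (p₁ vs₂ e) → 2 ≤ size vs₂ (p₂ vs₁ e) → ¬ ¬ Dispensable (Prod k H₁ H₂) e
    ¬¬-dispensable-non-cartesian thin₁ thin₂ {e} Ee 2≤size₁ 2≤size₂ ¬disp =
      let x₁ , y₁ , x₁∈ , _ = C₁.2≤size⇒distinct 2≤size₁
          (x₁ , x₂) , (y₁ , y₂) , x∈e , y∈e , x₁≢y₁ , x₂≢y₂ =
            crossing-pair _≟₁_ _≟₂_ (_∈ₛ e) (_ , proj₂ (p₁⁻ {e} x₁∈)) (spread₁ 2≤size₁) (spread₂ 2≤size₂)
          x₁~y₁ , x₂~y₂ = prod-neighbours k Ee x∈e y∈e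
          y₁~x₁ , y₂~x₂ = prod-neighbours k Ee y∈e x∈e
      in  crossing-dispensed x₁~y₁ y₁~x₁ x₂~y₂ y₂~x₂ (thin₁ x₁ y₁ x₁≢y₁) (thin₂ x₂ y₂ x₂≢y₂)
            (λ z d → ¬disp (z , _ , _ , x₁≢y₁ ∘ cong proj₁ , x∈e , y∈e , Dispenses-⊗⇒Prod d))

proposition3p9 : (k : ProductKind) {V₁ V₂ : Set} (H₁ : Hypergraph V₁) (H₂ : Hypergraph V₂)
    → Thin H₁ → Thin H₂
    → ∀ e → Skel (Prod k H₁ H₂) e
          ⇔ Cart (Hypergraph.vertices H₁) (Hypergraph.vertices H₂)
                 (Skel (Hypergraph.Edge H₁)) (Skel (Hypergraph.Edge H₂)) e
proposition3p9 k H₁ H₂ thin₁ thin₂ e = mk⇔ to from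
  where
  open HypergraphProduct H₁ H₂
  open Skeleton k
  to : Skel (Prod k H₁ H₂) e → Cart vs₁ vs₂ (Skel E₁) (Skel E₂) e
  to (Ee , ¬disp) with prod-edge-cases k Ee
  ... | inj₁ (inj₁ (E , size≡1)) = inj₁ ((E , ¬disp ∘ Equivalence.from (Dispensable-row size≡1)) , size≡1)
  ... | inj₁ (inj₂ (E , size≡1)) = inj₂ ((E , ¬disp ∘ Equivalence.from (Dispensable-col size≡1)) , size≡1)
  ... | inj₂ (2≤size₁ , 2≤size₂) = ⊥-elim (¬¬-dispensable-non-cartesian thin₁ thin₂ Ee 2≤size₁ 2≤size₂ ¬disp)
  from : Cart vs₁ vs₂ (Skel E₁) (Skel E₂) e → Skel (Prod k H₁ H₂) e
  from (inj₁ ((E , ¬disp) , size≡1)) =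
    cart⇒prod k (inj₁ (E , size≡1)) , ¬disp ∘ Equivalence.to (Dispensable-row size≡1)
  from (inj₂ ((E , ¬disp) , size≡1)) =
    cart⇒prod k (inj₂ (E , size≡1)) , ¬disp ∘ Equivalence.to (Dispensable-col size≡1)
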